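{- Let $G$ be a 2-connected non-bipartite cubic graph with a 2-cut. Then $G$ has a 2-cut $\partial(X)=\{ab,cd\}$ with $a,c\in X$ such that $G[X]+ac$ is a 2-connected non-bipartite simple cubic graph and, among all 2-cuts $\partial(Y)=\{a'b',c'd'\}$ with $a',c'\in Y$ for which $G[Y]+a'c'$ is a 2-connected non-bipartite simple cubic graph, $G[X]+ac$ has the minimum number of vertices.
   Context: All graphs are finite, simple and connected. For $\emptyset\ne X\subsetneq V(G)$, $\partial(X)$ is the set of edges with exactly one end in $X$; a 2-cut is an edge cut with exactly 2 edges. -}

module Defs where

open import Data.Nat using (ℕ; zero; suc; _+_; _≤_)
open import Data.Fin using (Fin; _≟_)
open import Data.Bool using (Bool; true; false; _∧_; _∨_; if_then_else_)
open import Data.List using (List; map; allFin)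
open import Data.Nat.ListAction using (sum)
open import Data.Product using (Σ; _×_)
open import Data.Sum using (_⊎_)
open import Relation.Nullary using (¬_)
open import Relation.Nullary.Decidable using (⌊_⌋)
open import Relation.Binary.PropositionalEquality using (_≡_; _≢_)

Adj : ℕ → Set
Adj n = Fin n → Fin n → Bool

record SimpleGraph (n : ℕ) : Set where
  field
    adj    : Adj n
    sym    : ∀ u v → adj u v ≡ adj v u
    irrefl : ∀ u → adj u u ≡ false
open SimpleGraph public

VSet : ℕ → Set
VSet n = Fin n → Bool

full : ∀ {n} → VSet n
full _ = true

_∈V_ : ∀ {n} → Fin n → VSet n → Set
u ∈V X = X u ≡ true

card : ∀ {n} → VSet n → ℕ
card {n} X = sum (map (λ w → if X w then 1 else 0) (allFin n))

-- In what follows, a graph "H on vertex set V" is a pair (A , V) of an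
-- adjacency relation A and a vertex set V; only edges between vertices
-- of V count.

deg : ∀ {n} → Adj n → VSet n → Fin n → ℕ
deg {n} A V u = sum (map (λ w → if V w ∧ A u w then 1 else 0) (allFin n))

Cubic : ∀ {n} → Adj n → VSet n → Set
Cubic A V = ∀ u → u ∈V V → deg A V u ≡ 3

data Walk {n} (A : Adj n) (P : Fin n → Set) : Fin n → Fin n → Set where
  []   : ∀ {u} → P u → Walk A P u u
  step : ∀ {u w v} → P u → A u w ≡ true → Walk A P w v → Walk A P u v

ConnectedOn : ∀ {n} → Adj n → (Fin n → Set) → Set
ConnectedOn A P = ∀ u v → P u → P v → Walk A P u v

TwoConnected : ∀ {n} → Adj n → VSet n → Set
TwoConnected A V =
  (3 ≤ card V)
  × ConnectedOn A (λ u → u ∈V V)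
  × (∀ x → x ∈V V → ConnectedOn A (λ u → (u ∈V V) × (u ≢ x)))

Bipartite : ∀ {n} → Adj n → VSet n → Set
Bipartite {n} A V =
  Σ (Fin n → Bool) λ col →
    ∀ u v → u ∈V V → v ∈V V → A u v ≡ true → col u ≢ col v

TwoCut : ∀ {n} → SimpleGraph n → VSet n → (a b c d : Fin n) → Set
TwoCut G X a b c d =
  (a ∈V X) × (c ∈V X) × (X b ≡ false) × (X d ≡ false)
  × (adj G a b ≡ true) × (adj G c d ≡ true)
  × ¬ ((a ≡ c) × (b ≡ d))
  × (∀ u v → adj G u v ≡ true → u ∈V X → X v ≡ false →
       ((u ≡ a) × (v ≡ b)) ⊎ ((u ≡ c) × (v ≡ d)))

inducedPlus : ∀ {n} → SimpleGraph n → VSet n → Fin n → Fin n → Adj n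
inducedPlus G X a c u v =
  (adj G u v ∧ X u ∧ X v)
  ∨ (⌊ u ≟ a ⌋ ∧ ⌊ v ≟ c ⌋) ∨ (⌊ u ≟ c ⌋ ∧ ⌊ v ≟ a ⌋)

-- G[X] + ac is a 2-connected non-bipartite simple cubic graph.
-- Simplicity of G[X] + ac: no loop (a ≠ c) and no parallel edge (ac ∉ E(G)).
GoodSide : ∀ {n} → SimpleGraph n → VSet n → Fin n → Fin n → Set
GoodSide G X a c =
  (a ≢ c) × (adj G a c ≡ false)
  × TwoConnected (inducedPlus G X a c) X
  × ¬ Bipartite (inducedPlus G X a c) X
  × Cubic (inducedPlus G X a c) X

{-# OPTIONS --safe #-}
module Submission where

-- Call Y an odd side if ∂(Y) = {ab, cd} with a, c ∈ Y and G[Y] + ac is not bipartite, i.e. G[Y]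
-- has no proper 2-colouring giving a and c different colours. Odd sides exist: if neither side
-- of the given 2-cut were odd, colourings of both sides separating their cut ends could be
-- glued, after possibly swapping colours on one side, into a 2-colouring of G. Take an odd side
-- X of minimum size; everything is finite, so this minimum can be computed. Two-connectivity
-- forces a ≠ c, and a, c are not adjacent in G: otherwise X − {a, c} is a smaller odd side, cut
-- off by the edges from a and c to their third neighbours. So G[X] + ac is simple; it is cubic
-- because ac replaces the cut edges at a and c, and 2-connected because every excursion of a
-- path of G outside X enters and leaves X through a and c. Every side in the statement is odd,
-- so X is minimal among them too.

open import Data.Bool using (Bool; true; false; _∧_; _∨_; not; if_then_else_)
import Data.Bool.Properties as Bool
open import Data.Bool.Properties
  using (∧-zeroʳ; ∨-zeroʳ; ∨-identityʳ; ∨-comm; T-∨; T-≡; T-∧; ¬-not; not-¬; not-injective; not-involutive)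
open import Data.Empty using (⊥-elim)
open import Data.Fin using (Fin; zero; suc; _≟_)
open import Data.Fin.Properties using (any?; all?)
open import Data.Fin.Subset.Properties using (anySubset?)
open import Data.List using (List; []; _∷_; length)
import Data.List.Membership.DecPropositional as DecMembership
open import Data.List.Membership.Propositional using (_∈_; _∉_)
open import Data.List.Properties using (map-tabulate)
open import Data.List.Relation.Unary.All as All using (All; []; _∷_)
open import Data.List.Relation.Unary.All.Properties using (¬Any⇒All¬)
open import Data.List.Relation.Unary.Any using (here; there)
open import Data.List.Relation.Unary.Unique.Propositional using (Unique; []; _∷_)
open import Data.Nat using (ℕ; zero; suc; _+_; _≤_; _<_; z≤n; s≤s; _<?_)
open import Data.Nat.Induction using (<-wellFounded)
open import Data.Nat.ListAction using (sum)
open import Data.Nat.Properties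
  using (+-commutativeSemigroup; +-mono-≤; n<1+n; 1+n≰n; <⇒≱; ≮⇒≥; ≤-trans; ≤-reflexive; module ≤-Reasoning)
open import Algebra.Properties.CommutativeSemigroup +-commutativeSemigroup using (x∙yz≈y∙xz)
open import Data.Product using (Σ; ∃; ∃-syntax; _×_; _,_; proj₁; proj₂)
import Data.Product as Product
open import Data.Sum using (_⊎_; inj₁; inj₂)
import Data.Sum as Sum
import Data.Vec as Vec
import Data.Vec.Properties as Vec
open import Data.Vec.Functional using (updateAt)
open import Data.Vec.Functional.Properties using (updateAt-updates; updateAt-minimal)
open import Defs renaming (sym to adj-sym; irrefl to adj-irrefl)
open import Function using (_∘_; const)
open import Function.Bundles using (module Equivalence)
open import Induction.WellFounded using (Acc; acc)
open import Relation.Binary.PropositionalEquality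
  using (_≡_; _≢_; _≗_; refl; sym; trans; cong; cong₂; subst; module ≡-Reasoning)
open import Relation.Nullary using (¬_; Dec; yes; no; contradiction; ¬?; _×-dec_; _→-dec_; _⊎-dec_)
import Relation.Nullary.Decidable as Dec
open import Relation.Nullary.Decidable using (decidable-stable; ⌊_⌋; isYes≗does; dec-true; toWitness)

private variable
  n : ℕ
  a b c d s t u v w : Fin n
  X Y : VSet n

toℕ : Bool → ℕ
toℕ b = if b then 1 else 0

toℕ≤1 : ∀ b → toℕ b ≤ 1
toℕ≤1 true  = s≤s z≤n
toℕ≤1 false = z≤n

∈-∉⇒≢ : u ∈V X → X v ≡ false → u ≢ v
∈-∉⇒≢ u∈X v∉X refl = contradiction (trans (sym u∈X) v∉X) λ ()

_─_ : VSet n → Fin n → VSet n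
X ─ p = updateAt X p (const false)

card-suc : (X : VSet (suc n)) → card X ≡ toℕ (X zero) + card (X ∘ suc)
card-suc X = cong (toℕ (X zero) +_) (cong sum
  (trans (map-tabulate suc (toℕ ∘ X)) (sym (map-tabulate (λ w → w) (toℕ ∘ X ∘ suc)))))

card-cong : {X Y : VSet n} → X ≗ Y → card X ≡ card Y
card-cong {zero}  X≗Y = refl
card-cong {suc n} {X} {Y} X≗Y = begin
  card X                          ≡⟨ card-suc X ⟩
  toℕ (X zero) + card (X ∘ suc)   ≡⟨ cong₂ _+_ (cong toℕ (X≗Y zero)) (card-cong (X≗Y ∘ suc)) ⟩
  toℕ (Y zero) + card (Y ∘ suc)   ≡⟨ sym (card-suc Y) ⟩
  card Y                          ∎
  where open ≡-Reasoning

card-remove : (X : VSet n) (p : Fin n) → card X ≡ toℕ (X p) + card (X ─ p)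
card-remove {suc n} X zero = trans (card-suc X) (cong (toℕ (X zero) +_) (sym (card-suc (X ─ zero))))
card-remove {suc n} X (suc p) = begin
  card X                                                  ≡⟨ card-suc X ⟩
  toℕ (X zero) + card (X ∘ suc)                           ≡⟨ cong (toℕ (X zero) +_) (card-remove (X ∘ suc) p) ⟩
  toℕ (X zero) + (toℕ (X (suc p)) + card ((X ∘ suc) ─ p)) ≡⟨ x∙yz≈y∙xz (toℕ (X zero)) (toℕ (X (suc p))) _ ⟩
  toℕ (X (suc p)) + (toℕ (X zero) + card ((X ∘ suc) ─ p)) ≡⟨ cong (toℕ (X (suc p)) +_) (sym (card-suc (X ─ suc p))) ⟩
  toℕ (X (suc p)) + card (X ─ suc p)                      ∎
  where open ≡-Reasoning

card-remove-∈ : (X : VSet n) (p : Fin n) → p ∈V X → card X ≡ suc (card (X ─ p))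
card-remove-∈ X p p∈X = trans (card-remove X p) (cong (λ β → toℕ β + card (X ─ p)) p∈X)

─-∈ : {X : VSet n} {p w : Fin n} → w ∈V X → w ≢ p → w ∈V (X ─ p)
─-∈ {X = X} {p} {w} w∈X w≢p = trans (updateAt-minimal w p X w≢p) w∈X

∈-─ : {X : VSet n} {p w : Fin n} → w ∈V (X ─ p) → w ∈V X × w ≢ p
∈-─ {X = X} {p} {w} w∈X─p with w ≟ p
... | yes refl = contradiction (trans (sym w∈X─p) (updateAt-updates p X)) λ ()
... | no w≢p = trans (sym (updateAt-minimal w p X w≢p)) w∈X─p , w≢p

card-∅ : (X : VSet n) → (∀ w → ¬ w ∈V X) → card X ≡ 0
card-∅ {zero}  X X∅ = refl
card-∅ {suc n} X X∅ =
  trans (card-suc X) (cong₂ _+_ (cong toℕ (¬-not (X∅ zero))) (card-∅ (X ∘ suc) (X∅ ∘ suc)))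

card-≤-length : (X : VSet n) (xs : List (Fin n)) → (∀ w → w ∈V X → w ∈ xs) → card X ≤ length xs
card-≤-length X [] X⊆[] = ≤-reflexive (card-∅ X λ w w∈X → contradiction (X⊆[] w w∈X) λ ())
card-≤-length X (x ∷ xs) X⊆xs = begin
  card X                  ≡⟨ card-remove X x ⟩
  toℕ (X x) + card (X ─ x) ≤⟨ +-mono-≤ (toℕ≤1 (X x)) (card-≤-length (X ─ x) xs X─x⊆xs) ⟩
  suc (length xs)         ∎
  where
  open ≤-Reasoning
  X─x⊆xs : ∀ w → w ∈V (X ─ x) → w ∈ xs
  X─x⊆xs w w∈X─x with ∈-─ {X = X} w∈X─x
  ... | w∈X , w≢x with X⊆xs w w∈X
  ...   | here w≡x   = contradiction w≡x w≢x
  ...   | there w∈xs = w∈xs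

length-≤-card : (X : VSet n) (xs : List (Fin n)) → Unique xs → All (_∈V X) xs → length xs ≤ card X
length-≤-card X []       []                  []            = z≤n
length-≤-card X (x ∷ xs) (x≢xs ∷ xs-unique) (x∈X ∷ xs⊆X) = begin
  suc (length xs)      ≤⟨ s≤s (length-≤-card (X ─ x) xs xs-unique xs⊆X─x) ⟩
  suc (card (X ─ x))   ≡⟨ sym (card-remove-∈ X x x∈X) ⟩
  card X               ∎
  where
  open ≤-Reasoning
  xs⊆X─x : All (_∈V (X ─ x)) xs
  xs⊆X─x = All.zipWith (λ (y∈X , x≢y) → ─-∈ {X = X} y∈X (x≢y ∘ sym)) (xs⊆X , x≢xs)

_∈?_ : (w : Fin n) (xs : List (Fin n)) → Dec (w ∈ xs)
_∈?_ = DecMembership._∈?_ _≟_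

length<card⇒∃∉ : (X : VSet n) (xs : List (Fin n)) → length xs < card X → ∃ λ w → w ∈V X × w ∉ xs
length<card⇒∃∉ X xs |xs|<|X| with any? (λ w → (X w Bool.≟ true) ×-dec ¬? (w ∈? xs))
... | yes found = found
... | no ∄w = contradiction (card-≤-length X xs X⊆xs) (<⇒≱ |xs|<|X|)
  where
  X⊆xs : ∀ w → w ∈V X → w ∈ xs
  X⊆xs w w∈X = decidable-stable (w ∈? xs) (λ w∉xs → ∄w (w , w∈X , w∉xs))

card≡length⇒⊆ : (X : VSet n) (xs : List (Fin n)) → Unique xs → All (_∈V X) xs → card X ≡ length xs
  → ∀ w → w ∈V X → w ∈ xs
card≡length⇒⊆ X xs xs-unique xs⊆X |X|≡|xs| w w∈X = decidable-stable (w ∈? xs) λ w∉xs →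
  1+n≰n (≤-trans (length-≤-card X (w ∷ xs) (¬Any⇒All¬ xs w∉xs ∷ xs-unique) (w∈X ∷ xs⊆X))
                 (≤-reflexive |X|≡|xs|))

card-exchange : (X Y : VSet n) {p q : Fin n} → p ∈V X → X q ≡ false → Y p ≡ false → q ∈V Y
  → (∀ w → w ≢ p → w ≢ q → X w ≡ Y w) → card X ≡ card Y
card-exchange X Y {p} {q} p∈X q∉X p∉Y q∈Y agree = begin
  card X             ≡⟨ card-remove-∈ X p p∈X ⟩
  suc (card (X ─ p)) ≡⟨ cong suc (card-cong X─p≗Y─q) ⟩
  suc (card (Y ─ q)) ≡⟨ sym (card-remove-∈ Y q q∈Y) ⟩
  card Y             ∎
  where
  open ≡-Reasoning
  p≢q = ∈-∉⇒≢ p∈X q∉X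
  X─p≗Y─q : X ─ p ≗ Y ─ q
  X─p≗Y─q w with w ≟ p | w ≟ q
  ... | yes refl | _        = trans (updateAt-updates p X) (sym (trans (updateAt-minimal p q Y p≢q) p∉Y))
  ... | no w≢p   | yes refl = trans (updateAt-minimal q p X w≢p) (trans q∉X (sym (updateAt-updates q Y)))
  ... | no w≢p   | no w≢q   =
    trans (updateAt-minimal w p X w≢p) (trans (agree w w≢p w≢q) (sym (updateAt-minimal w q Y w≢q)))

anyVSet? : {P : VSet n → Set} → (∀ {X Y} → X ≗ Y → P X → P Y) → (∀ X → Dec (P X)) → Dec (∃ P)
anyVSet? resp P? = Dec.map′ (λ (v , Pv) → Vec.lookup v , Pv)
  (λ (X , PX) → Vec.tabulate X , resp (sym ∘ Vec.lookup∘tabulate X) PX)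
  (anySubset? (P? ∘ Vec.lookup))

module _ {A : Set} {P : A → Set} (μ : A → ℕ) (smaller? : ∀ k → Dec (∃ λ y → P y × μ y < k)) where

  ∃-minimal : ∃ P → ∃ λ x → P x × (∀ y → P y → μ x ≤ μ y)
  ∃-minimal (x , Px) = descend x Px (<-wellFounded (μ x))
    where
    descend : ∀ x → P x → Acc _<_ (μ x) → ∃ λ x → P x × (∀ y → P y → μ x ≤ μ y)
    descend x Px (acc smaller) with smaller? (μ x)
    ... | yes (y , Py , μy<μx) = descend y Py (smaller μy<μx)
    ... | no ∄y                = x , Px , λ y Py → ≮⇒≥ (λ μy<μx → ∄y (y , Py , μy<μx))

walk-map : {A : Adj n} {P Q : Fin n → Set} → (∀ {u} → P u → Q u) → Walk A P s t → Walk A Q s t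
walk-map P⇒Q ([] Ps)          = [] (P⇒Q Ps)
walk-map P⇒Q (step Ps sw rest) = step (P⇒Q Ps) sw (walk-map P⇒Q rest)

walk-exit : {A : Adj n} {P : Fin n → Set} (X : VSet n) → Walk A P s t → s ∈V X → X t ≡ false
  → ∃[ u ] ∃[ v ] P u × A u v ≡ true × u ∈V X × X v ≡ false
walk-exit X ([] _) s∈X t∉X = contradiction refl (∈-∉⇒≢ {X = X} s∈X t∉X)
walk-exit X (step {u} {w} Pu uw rest) u∈X t∉X with X w in Xw
... | true  = walk-exit X rest Xw t∉X
... | false = u , w , Pu , uw , u∈X , Xw

Proper : Adj n → VSet n → (Fin n → Bool) → Set
Proper A V col = ∀ u v → u ∈V V → v ∈V V → A u v ≡ true → col u ≢ col v

proper? : (A : Adj n) (V : VSet n) (col : Fin n → Bool) → Dec (Proper A V col)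
proper? A V col = all? λ u → all? λ v →
  (V u Bool.≟ true) →-dec (V v Bool.≟ true) →-dec (A u v Bool.≟ true) →-dec ¬? (col u Bool.≟ col v)

proper-resp : {A : Adj n} {V V′ : VSet n} {col col′ : Fin n → Bool} → V ≗ V′ → col ≗ col′
  → Proper A V col → Proper A V′ col′
proper-resp V≗V′ col≗col′ proper u v u∈V′ v∈V′ uv col′u≡col′v =
  proper u v (trans (V≗V′ u) u∈V′) (trans (V≗V′ v) v∈V′) uv
    (trans (col≗col′ u) (trans col′u≡col′v (sym (col≗col′ v))))

SeparatingColouring : SimpleGraph n → VSet n → Fin n → Fin n → Set
SeparatingColouring G Y a c = ∃ λ col → Proper (adj G) Y col × col a ≢ col c

separating? : (G : SimpleGraph n) (Y : VSet n) (a c : Fin n) → Dec (SeparatingColouring G Y a c)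
separating? G Y a c = anyVSet?
  (λ col≗col′ (proper , a≢c) → proper-resp (λ _ → refl) col≗col′ proper ,
                                 λ eq → a≢c (trans (col≗col′ a) (trans eq (sym (col≗col′ c)))))
  (λ col → proper? (adj G) Y col ×-dec ¬? (col a Bool.≟ col c))

separating-resp : {G : SimpleGraph n} → X ≗ Y → SeparatingColouring G X a c → SeparatingColouring G Y a c
separating-resp X≗Y (col , proper , a≢c) = col , proper-resp X≗Y (λ _ → refl) proper , a≢c

≟-refl : (u : Fin n) → ⌊ u ≟ u ⌋ ≡ true
≟-refl u = trans (isYes≗does (u ≟ u)) (dec-true (u ≟ u) refl)

⌊≟∧≟⌋-false : ¬ (u ≡ a × v ≡ c) → ⌊ u ≟ a ⌋ ∧ ⌊ v ≟ c ⌋ ≡ false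
⌊≟∧≟⌋-false {u = u} {a = a} {v = v} {c = c} ¬eq with u ≟ a | v ≟ c
... | yes u≡a | yes v≡c = contradiction (u≡a , v≡c) ¬eq
... | yes _   | no _    = refl
... | no _    | _       = refl

module _ (G : SimpleGraph n) where

  adj-flip : adj G u v ≡ true → adj G v u ≡ true
  adj-flip {u} {v} = trans (adj-sym G v u)

  twoCut? : (X : VSet n) (a b c d : Fin n) → Dec (TwoCut G X a b c d)
  twoCut? X a b c d =
    (X a Bool.≟ true) ×-dec (X c Bool.≟ true) ×-dec (X b Bool.≟ false) ×-dec (X d Bool.≟ false)
    ×-dec (adj G a b Bool.≟ true) ×-dec (adj G c d Bool.≟ true) ×-dec ¬? ((a ≟ c) ×-dec (b ≟ d))
    ×-dec (all? λ u → all? λ v → (adj G u v Bool.≟ true) →-dec (X u Bool.≟ true) →-dec (X v Bool.≟ false)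
            →-dec (((u ≟ a) ×-dec (v ≟ b)) ⊎-dec ((u ≟ c) ×-dec (v ≟ d))))

  twoCut-resp : X ≗ Y → TwoCut G X a b c d → TwoCut G Y a b c d
  twoCut-resp {X = X} {Y} X≗Y (a∈X , c∈X , b∉X , d∉X , ab , cd , ab≢cd , ∂X) =
    ∈Y a∈X , ∈Y c∈X , ∈Y b∉X , ∈Y d∉X , ab , cd , ab≢cd ,
    λ u v uv u∈Y v∉Y → ∂X u v uv (∈X u∈Y) (∈X v∉Y)
    where
    ∈Y : ∀ {w β} → X w ≡ β → Y w ≡ β
    ∈Y {w} = trans (sym (X≗Y w))
    ∈X : ∀ {w β} → Y w ≡ β → X w ≡ β
    ∈X {w} = trans (X≗Y w)

  twoCut-swap : TwoCut G X a b c d → TwoCut G X c d a b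
  twoCut-swap (a∈X , c∈X , b∉X , d∉X , ab , cd , ab≢cd , ∂X) =
    c∈X , a∈X , d∉X , b∉X , cd , ab , (λ (c≡a , d≡b) → ab≢cd (sym c≡a , sym d≡b)) ,
    λ u v uv u∈X v∉X → Sum.swap (∂X u v uv u∈X v∉X)

  twoCut-complement : TwoCut G X a b c d → TwoCut G (not ∘ X) b a d c
  twoCut-complement (a∈X , c∈X , b∉X , d∉X , ab , cd , ab≢cd , ∂X) =
    cong not b∉X , cong not d∉X , cong not a∈X , cong not c∈X , adj-flip ab , adj-flip cd ,
    (λ (b≡d , a≡c) → ab≢cd (a≡c , b≡d)) ,
    λ u v uv u∉X v∈X → Sum.map Product.swap Product.swap
      (∂X v u (adj-flip uv) (not-injective v∈X) (not-injective u∉X))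

  OddSide : VSet n → Set
  OddSide Y = ∃[ a ] ∃[ b ] ∃[ c ] ∃[ d ] TwoCut G Y a b c d × ¬ SeparatingColouring G Y a c

  oddSide? : (Y : VSet n) → Dec (OddSide Y)
  oddSide? Y = any? λ a → any? λ b → any? λ c → any? λ d → twoCut? Y a b c d ×-dec ¬? (separating? G Y a c)

  oddSide-resp : X ≗ Y → OddSide X → OddSide Y
  oddSide-resp X≗Y (a , b , c , d , cut , ¬sep) =
    a , b , c , d , twoCut-resp X≗Y cut , ¬sep ∘ separating-resp {G = G} (sym ∘ X≗Y)

  smaller-oddSide? : ∀ k → Dec (∃ λ Y → OddSide Y × card Y < k)
  smaller-oddSide? k =
    anyVSet? (λ X≗Y (odd , small) → oddSide-resp X≗Y odd , subst (_< k) (card-cong X≗Y) small)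
             (λ Y → oddSide? Y ×-dec (card Y <? k))

  recolour : {g : Fin n → Bool} → Proper (adj G) Y g → g b ≢ g d → (β : Bool)
    → ∃ λ g′ → Proper (adj G) Y g′ × g′ b ≡ β × g′ d ≡ not β
  recolour {Y = Y} {b = b} {g = g} proper gb≢gd β with g b Bool.≟ β
  ... | yes gb≡β  = g , proper , gb≡β , trans gd≡¬gb (cong not gb≡β)
    where gd≡¬gb = ¬-not (gb≢gd ∘ sym)
  ... | no gb≢β =
    not ∘ g , flipped , trans (cong not (¬-not gb≢β)) (not-involutive β) , trans (sym gb≡¬gd) (¬-not gb≢β)
    where
    gb≡¬gd = ¬-not gb≢gd
    flipped : Proper (adj G) Y (not ∘ g)
    flipped u v u∈Y v∈Y uv = proper u v u∈Y v∈Y uv ∘ not-injective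

  separating-sides⇒bipartite : TwoCut G X a b c d → SeparatingColouring G X a c
    → SeparatingColouring G (not ∘ X) b d → Bipartite (adj G) full
  separating-sides⇒bipartite {X = X} {a} (_ , _ , _ , _ , _ , _ , _ , ∂X)
                             (f , f-proper , fa≢fc) (g , g-proper , gb≢gd)
    with recolour g-proper gb≢gd (not (f a))
  ... | g′ , g′-proper , g′b≡¬fa , g′d≡¬¬fa = h , h-proper
    where
    h : Fin n → Bool
    h w = if X w then f w else g′ w
    crossing : ∀ u v → adj G u v ≡ true → u ∈V X → X v ≡ false → f u ≢ g′ v
    crossing u v uv u∈X v∉X with ∂X u v uv u∈X v∉X
    ... | inj₁ (refl , refl) = λ fa≡g′b → not-¬ refl (trans fa≡g′b g′b≡¬fa)
    ... | inj₂ (refl , refl) = λ fc≡g′d → fa≢fc (sym (trans fc≡g′d (trans g′d≡¬¬fa (not-involutive (f a)))))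
    h-proper : Proper (adj G) full h
    h-proper u v _ _ uv with X u in Xu | X v in Xv
    ... | true  | true  = f-proper u v Xu Xv uv
    ... | false | false = g′-proper u v (cong not Xu) (cong not Xv) uv
    ... | true  | false = crossing u v uv Xu Xv
    ... | false | true  = crossing v u (adj-flip uv) Xv Xu ∘ sym

  oddSide-exists : ¬ Bipartite (adj G) full → TwoCut G X a b c d → ∃ OddSide
  oddSide-exists {X = X} {a} {b} {c} {d} ¬bipartite cut
    with separating? G X a c | separating? G (not ∘ X) b d
  ... | no ¬sep | _        = X , a , b , c , d , cut , ¬sep
  ... | yes _   | no ¬sep′ = not ∘ X , b , a , d , c , twoCut-complement cut , ¬sep′
  ... | yes sep | yes sep′ = contradiction (separating-sides⇒bipartite cut sep sep′) ¬bipartite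

  module _ (X : VSet n) (a c : Fin n) where

    inducedPlus-edge : adj G u v ≡ true → u ∈V X → v ∈V X → inducedPlus G X a c u v ≡ true
    inducedPlus-edge uv u∈X v∈X rewrite uv | u∈X | v∈X = refl

    inducedPlus-ac : inducedPlus G X a c a c ≡ true
    inducedPlus-ac rewrite ≟-refl a | ≟-refl c = ∨-zeroʳ _

    inducedPlus-comm : ∀ u v → inducedPlus G X a c u v ≡ inducedPlus G X c a u v
    inducedPlus-comm u v = cong (adj G u v ∧ X u ∧ X v ∨_) (∨-comm (⌊ u ≟ a ⌋ ∧ ⌊ v ≟ c ⌋) _)

    inducedPlus-cases : inducedPlus G X a c u v ≡ true → adj G u v ≡ true ⊎ (u ≡ a × v ≡ c) ⊎ (u ≡ c × v ≡ a)
    inducedPlus-cases {u} {v} H-uv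
      with Equivalence.to (T-∨ {adj G u v ∧ X u ∧ X v}) (Equivalence.from T-≡ H-uv)
    ... | inj₁ T-edge = inj₁ (Equivalence.to T-≡ (proj₁ (Equivalence.to (T-∧ {adj G u v}) T-edge)))
    ... | inj₂ T-added with Equivalence.to (T-∨ {⌊ u ≟ a ⌋ ∧ ⌊ v ≟ c ⌋}) T-added
    ...   | inj₁ T-ac = let (u≟a , v≟c) = Equivalence.to (T-∧ {⌊ u ≟ a ⌋}) T-ac
                        in inj₂ (inj₁ (toWitness u≟a , toWitness v≟c))
    ...   | inj₂ T-ca = let (u≟c , v≟a) = Equivalence.to (T-∧ {⌊ u ≟ c ⌋}) T-ca
                        in inj₂ (inj₂ (toWitness u≟c , toWitness v≟a))

    inducedPlus-off-ac : ¬ (u ≡ a × v ≡ c) → ¬ (u ≡ c × v ≡ a)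
      → inducedPlus G X a c u v ≡ adj G u v ∧ X u ∧ X v
    inducedPlus-off-ac {u} {v} ¬ac ¬ca rewrite ⌊≟∧≟⌋-false ¬ac | ⌊≟∧≟⌋-false ¬ca = ∨-identityʳ _

    inducedPlus-neighbourhood : u ∈V X → ¬ (u ≡ a × w ≡ c) → ¬ (u ≡ c × w ≡ a) → (adj G u w ≡ true → w ∈V X)
      → X w ∧ inducedPlus G X a c u w ≡ adj G u w
    inducedPlus-neighbourhood {u} {w} u∈X ¬ac ¬ca closed
      rewrite inducedPlus-off-ac ¬ac ¬ca | u∈X with adj G u w
    ... | true rewrite closed refl = refl
    ... | false = ∧-zeroʳ (X w)

  adj⇒≢ : adj G u v ≡ true → u ≢ v
  adj⇒≢ {u} uv refl = contradiction (trans (sym uv) (adj-irrefl G u)) λ ()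

  cut-closed : TwoCut G X a b c d → u ∈V X → adj G u v ≡ true
    → ¬ (u ≡ a × v ≡ b) → ¬ (u ≡ c × v ≡ d) → v ∈V X
  cut-closed {X = X} {v = v} (_ , _ , _ , _ , _ , _ , _ , ∂X) u∈X uv ¬ab ¬cd with X v in Xv
  ... | true  = refl
  ... | false = ⊥-elim (Sum.[ ¬ab , ¬cd ] (∂X _ v uv u∈X Xv))

  module TwoCutParts {X : VSet n} {a b c d : Fin n} (cut : TwoCut G X a b c d) where

    a∈X : a ∈V X
    a∈X = proj₁ cut

    c∈X : c ∈V X
    c∈X = proj₁ (proj₂ cut)

    b∉X : X b ≡ false
    b∉X = proj₁ (proj₂ (proj₂ cut))

    d∉X : X d ≡ false
    d∉X = proj₁ (proj₂ (proj₂ (proj₂ cut)))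

    ab : adj G a b ≡ true
    ab = proj₁ (proj₂ (proj₂ (proj₂ (proj₂ cut))))

    cd : adj G c d ≡ true
    cd = proj₁ (proj₂ (proj₂ (proj₂ (proj₂ (proj₂ cut)))))

    ∂X : ∀ u v → adj G u v ≡ true → u ∈V X → X v ≡ false → (u ≡ a × v ≡ b) ⊎ (u ≡ c × v ≡ d)
    ∂X = proj₂ (proj₂ (proj₂ (proj₂ (proj₂ (proj₂ (proj₂ cut))))))

  module Projection {X : VSet n} {a b c d : Fin n} (cut : TwoCut G X a b c d) {P : Fin n → Set} where

    private
      H = inducedPlus G X a c
      P∩X = λ u → u ∈V X × P u
      End = λ e → e ≡ a ⊎ e ≡ c
      open TwoCutParts cut using (∂X)

      end-edge : End s → End t → s ≢ t → H s t ≡ true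
      end-edge (inj₁ refl) (inj₁ refl) s≢t = contradiction refl s≢t
      end-edge (inj₁ refl) (inj₂ refl) _   = inducedPlus-ac X a c
      end-edge (inj₂ refl) (inj₁ refl) _   = trans (inducedPlus-comm X a c c a) (inducedPlus-ac X c a)
      end-edge (inj₂ refl) (inj₂ refl) s≢t = contradiction refl s≢t

    -- An excursion of a walk outside X leaves and re-enters X through the ends a, c,
    -- so it can be replaced by the edge ac of G[X] + ac.
    project-in  : Walk (adj G) P s t → s ∈V X → t ∈V X → Walk H P∩X s t
    project-out : Walk (adj G) P s t → X s ≡ false → t ∈V X → ∃ λ e → End e × Walk H P∩X e t

    project-in ([] Ps) s∈X _ = [] (s∈X , Ps)
    project-in (step {s} {w} Ps sw rest) s∈X t∈X with X w in Xw
    ... | true = step (s∈X , Ps) (inducedPlus-edge X a c sw s∈X Xw) (project-in rest Xw t∈X)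
    ... | false with project-out rest Xw t∈X
    ...   | e , e-end , walk with s ≟ e
    ...     | yes refl = walk
    ...     | no s≢e   = step (s∈X , Ps) (end-edge (Sum.map proj₁ proj₁ (∂X s w sw s∈X Xw)) e-end s≢e) walk

    project-out ([] _) s∉X t∈X = contradiction refl (∈-∉⇒≢ {X = X} t∈X s∉X)
    project-out (step {s} {w} Ps sw rest) s∉X t∈X with X w in Xw
    ... | false = project-out rest Xw t∈X
    ... | true  = w , Sum.map proj₁ proj₁ (∂X w s (adj-flip sw) Xw s∉X) , project-in rest Xw t∈X

  side-nonbipartite : TwoCut G X a b c d → ¬ SeparatingColouring G X a c → ¬ Bipartite (inducedPlus G X a c) X
  side-nonbipartite {X = X} {a} {c = c} (a∈X , c∈X , _) ¬sep (col , proper) =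
    ¬sep (col , (λ u v u∈X v∈X uv → proper u v u∈X v∈X (inducedPlus-edge X a c uv u∈X v∈X)) ,
          proper a c a∈X c∈X (inducedPlus-ac X a c))

  goodSide⇒¬separating : GoodSide G X a c → ¬ SeparatingColouring G X a c
  goodSide⇒¬separating {X = X} {a} {c} (_ , _ , _ , ¬bipartite , _) (col , proper , a≢c) =
    ¬bipartite (col , proper+)
    where
    proper+ : Proper (inducedPlus G X a c) X col
    proper+ u v u∈X v∈X H-uv with inducedPlus-cases X a c H-uv
    ... | inj₁ uv                = proper u v u∈X v∈X uv
    ... | inj₂ (inj₁ (refl , refl)) = a≢c
    ... | inj₂ (inj₂ (refl , refl)) = a≢c ∘ sym

  module _ (two-connected : TwoConnected (adj G) full) (cubic : Cubic (adj G) full) where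

    private
      degree : ∀ u → card (adj G u) ≡ 3
      degree u = cubic u refl

    another-neighbour : ∀ u p q → ∃ λ w → adj G u w ≡ true × w ≢ p × w ≢ q
    another-neighbour u p q with length<card⇒∃∉ (adj G u) (p ∷ q ∷ []) (≤-reflexive (sym (degree u)))
    ... | w , uw , w∉pq = w , uw , w∉pq ∘ here , w∉pq ∘ there ∘ here

    third-neighbour-unique : ∀ {u p q r} → p ≢ q → p ≢ r → q ≢ r
      → adj G u p ≡ true → adj G u q ≡ true → adj G u r ≡ true → adj G u w ≡ true → w ≢ p → w ≢ q → w ≡ r
    third-neighbour-unique {w = w} {u} {p} {q} {r} p≢q p≢r q≢r up uq ur uw w≢p w≢q
      with card≡length⇒⊆ (adj G u) (p ∷ q ∷ r ∷ []) ((p≢q ∷ p≢r ∷ []) ∷ (q≢r ∷ []) ∷ [] ∷ [])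
             (up ∷ uq ∷ ur ∷ []) (degree u) w uw
    ... | here w≡p                 = contradiction w≡p w≢p
    ... | there (here w≡q)         = contradiction w≡q w≢q
    ... | there (there (here w≡r)) = w≡r

    twoCut-ends-distinct : TwoCut G X a b c d → a ≢ c
    twoCut-ends-distinct {X = X} {a} {b} {d = d} cut@(a∈X , _ , b∉X , _ , _ , _ , _ , ∂X) refl
      with another-neighbour a b d
    ... | x , ax , x≢b , x≢d
      with walk-exit X (proj₂ (proj₂ two-connected) a refl x b (refl , adj⇒≢ ax ∘ sym)
                                                               (refl , ∈-∉⇒≢ a∈X b∉X ∘ sym))
                       (cut-closed cut a∈X ax (x≢b ∘ proj₂) (x≢d ∘ proj₂)) b∉X
    ... | u , v , (_ , u≢a) , uv , u∈X , v∉X = u≢a (Sum.[ proj₁ , proj₁ ] (∂X u v uv u∈X v∉X))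

    side-card : TwoCut G X a b c d → 3 ≤ card X
    side-card {X = X} {a} {b} {c} cut@(a∈X , c∈X , _) with another-neighbour a b c
    ... | x , ax , x≢b , x≢c =
      length-≤-card X (a ∷ c ∷ x ∷ []) ((a≢c ∷ adj⇒≢ ax ∷ []) ∷ (x≢c ∘ sym ∷ []) ∷ [] ∷ [])
                                        (a∈X ∷ c∈X ∷ x∈X ∷ [])
      where
      a≢c = twoCut-ends-distinct cut
      x∈X = cut-closed cut a∈X ax (x≢b ∘ proj₂) (a≢c ∘ proj₁)

    side-twoConnected : TwoCut G X a b c d → TwoConnected (inducedPlus G X a c) X
    side-twoConnected {X = X} {a} {c = c} cut = side-card cut , connected , no-cut-vertex
      where
      open Projection cut
      connected : ConnectedOn (inducedPlus G X a c) (_∈V X)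
      connected u v u∈X v∈X = walk-map proj₁ (project-in (proj₁ (proj₂ two-connected) u v refl refl) u∈X v∈X)
      no-cut-vertex : ∀ z → z ∈V X → ConnectedOn (inducedPlus G X a c) (λ u → u ∈V X × u ≢ z)
      no-cut-vertex z _ u v (u∈X , u≢z) (v∈X , v≢z) = walk-map (λ (w∈X , _ , w≢z) → w∈X , w≢z)
        (project-in (proj₂ (proj₂ two-connected) z refl u v (refl , u≢z) (refl , v≢z)) u∈X v∈X)

    side-degree-end : TwoCut G X a b c d → adj G a c ≡ false → deg (inducedPlus G X a c) X a ≡ 3
    side-degree-end {X = X} {a} {b} {c} cut@(a∈X , c∈X , b∉X , _ , ab , _) ¬ac =
      trans (card-exchange _ (adj G a) {c} {b} c-in b-out ¬ac ab agree) (degree a)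
      where
      a≢c = twoCut-ends-distinct cut
      c-in : X c ∧ inducedPlus G X a c a c ≡ true
      c-in = cong₂ _∧_ c∈X (inducedPlus-ac X a c)
      b-out : X b ∧ inducedPlus G X a c a b ≡ false
      b-out = cong (_∧ inducedPlus G X a c a b) b∉X
      agree : ∀ w → w ≢ c → w ≢ b → X w ∧ inducedPlus G X a c a w ≡ adj G a w
      agree w w≢c w≢b = inducedPlus-neighbourhood X a c a∈X (w≢c ∘ proj₂) (a≢c ∘ proj₁)
        (λ aw → cut-closed cut a∈X aw (w≢b ∘ proj₂) (a≢c ∘ proj₁))

    side-cubic : TwoCut G X a b c d → adj G a c ≡ false → Cubic (inducedPlus G X a c) X
    side-cubic {X = X} {a} {c = c} cut ¬ac u u∈X = degree-at (u ≟ a) (u ≟ c)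
      where
      degree-at : Dec (u ≡ a) → Dec (u ≡ c) → deg (inducedPlus G X a c) X u ≡ 3
      degree-at (yes refl) _          = side-degree-end cut ¬ac
      degree-at (no _)     (yes refl) = trans (card-cong λ w → cong (X w ∧_) (inducedPlus-comm X a c u w))
                                              (side-degree-end (twoCut-swap cut) (trans (adj-sym G c a) ¬ac))
      degree-at (no u≢a)   (no u≢c)   =
        trans (card-cong λ w → inducedPlus-neighbourhood X a c {w = w} u∈X (u≢a ∘ proj₁) (u≢c ∘ proj₁)
                                 (λ uw → cut-closed cut u∈X uw (u≢a ∘ proj₁) (u≢c ∘ proj₁)))
              (degree u)

    module Shrink {X : VSet n} {a b c d x y : Fin n} (cut : TwoCut G X a b c d) (ac : adj G a c ≡ true)
                  (ax : adj G a x ≡ true) (x≢b : x ≢ b) (x≢c : x ≢ c)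
                  (cy : adj G c y ≡ true) (y≢d : y ≢ d) (y≢a : y ≢ a) where

      open TwoCutParts cut

      private
        a≢c : a ≢ c
        a≢c = twoCut-ends-distinct cut

        x∈X : x ∈V X
        x∈X = cut-closed cut a∈X ax (x≢b ∘ proj₂) (a≢c ∘ proj₁)

        x≢a : x ≢ a
        x≢a = adj⇒≢ ax ∘ sym

        y≢c : y ≢ c
        y≢c = adj⇒≢ cy ∘ sym

        y∈X : y ∈V X
        y∈X = cut-closed cut c∈X cy (a≢c ∘ sym ∘ proj₁) (y≢d ∘ proj₂)

        a-neighbour : adj G a w ≡ true → w ∈V X → w ≢ c → w ≡ x
        a-neighbour aw w∈X w≢c =
          third-neighbour-unique (∈-∉⇒≢ c∈X b∉X ∘ sym) (∈-∉⇒≢ x∈X b∉X ∘ sym) (x≢c ∘ sym)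
                                 ab ac ax aw (∈-∉⇒≢ w∈X b∉X) w≢c

        c-neighbour : adj G c w ≡ true → w ∈V X → w ≢ a → w ≡ y
        c-neighbour cw w∈X w≢a =
          third-neighbour-unique (∈-∉⇒≢ a∈X d∉X ∘ sym) (∈-∉⇒≢ y∈X d∉X ∘ sym) (y≢a ∘ sym)
                                 cd (adj-flip ac) cy cw (∈-∉⇒≢ w∈X d∉X) w≢a

      X′ : VSet n
      X′ = (X ─ a) ─ c

      private
        X′-agrees : w ≢ a → w ≢ c → X′ w ≡ X w
        X′-agrees {w} w≢a w≢c = trans (updateAt-minimal w c (X ─ a) w≢c) (updateAt-minimal w a X w≢a)

        X′-inner : w ∈V X′ → w ∈V X × w ≢ a × w ≢ c
        X′-inner {w} w∈X′ with ∈-─ {X = X ─ a} w∈X′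
        ... | w∈X─a , w≢c = proj₁ (∈-─ {X = X} w∈X─a) , proj₂ (∈-─ {X = X} w∈X─a) , w≢c

      card-X′<card-X : card X′ < card X
      card-X′<card-X = begin-strict
        card X′                  <⟨ n<1+n (card X′) ⟩
        suc (card X′)            ≡⟨ sym (card-remove-∈ (X ─ a) c (─-∈ {X = X} c∈X (a≢c ∘ sym))) ⟩
        card (X ─ a)             <⟨ n<1+n (card (X ─ a)) ⟩
        suc (card (X ─ a))       ≡⟨ sym (card-remove-∈ X a a∈X) ⟩
        card X                   ∎
        where open ≤-Reasoning

      twoCut′ : TwoCut G X′ x a y c
      twoCut′ = trans (X′-agrees x≢a x≢c) x∈X , trans (X′-agrees y≢a y≢c) y∈X , a∉X′ , c∉X′ ,
                adj-flip ax , adj-flip cy , a≢c ∘ proj₂ , ∂X′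
        where
        a∉X′ : X′ a ≡ false
        a∉X′ = trans (updateAt-minimal a c (X ─ a) a≢c) (updateAt-updates a X)
        c∉X′ : X′ c ≡ false
        c∉X′ = updateAt-updates c (X ─ a)
        ∂X′ : ∀ u v → adj G u v ≡ true → u ∈V X′ → X′ v ≡ false → (u ≡ x × v ≡ a) ⊎ (u ≡ y × v ≡ c)
        ∂X′ u v uv u∈X′ v∉X′ with X′-inner u∈X′ | v ≟ a | v ≟ c
        ... | u∈X , _   , u≢c | yes refl | _        = inj₁ (a-neighbour (adj-flip uv) u∈X u≢c , refl)
        ... | u∈X , u≢a , _   | no _     | yes refl = inj₂ (c-neighbour (adj-flip uv) u∈X u≢a , refl)
        ... | u∈X , u≢a , u≢c | no v≢a   | no v≢c   =
          ⊥-elim (Sum.[ u≢a ∘ proj₁ , u≢c ∘ proj₁ ]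
                   (∂X u v uv u∈X (trans (sym (X′-agrees v≢a v≢c)) v∉X′)))

      separating-extends : SeparatingColouring G X′ x y → SeparatingColouring G X a c
      separating-extends (col , proper , colx≢coly) = col′ , proper′ , at-ends a c (inj₁ refl) ac c∈X
        where
        col′ : Fin n → Bool
        col′ = updateAt (updateAt col a (const (col y))) c (const (col x))
        col′-a : col′ a ≡ col y
        col′-a = trans (updateAt-minimal a c _ a≢c) (updateAt-updates a col)
        col′-c : col′ c ≡ col x
        col′-c = updateAt-updates c _
        col′-inner : w ≢ a → w ≢ c → col′ w ≡ col w
        col′-inner {w} w≢a w≢c = trans (updateAt-minimal w c _ w≢c) (updateAt-minimal w a col w≢a)
        a-side : adj G a v ≡ true → v ∈V X → col′ v ≡ col x
        a-side {v} av v∈X with v ≟ c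
        ... | yes refl = col′-c
        ... | no v≢c rewrite a-neighbour av v∈X v≢c = col′-inner x≢a x≢c
        c-side : adj G c v ≡ true → v ∈V X → col′ v ≡ col y
        c-side {v} cv v∈X with v ≟ a
        ... | yes refl = col′-a
        ... | no v≢a rewrite c-neighbour cv v∈X v≢a = col′-inner y≢a y≢c
        at-ends : ∀ u v → u ≡ a ⊎ u ≡ c → adj G u v ≡ true → v ∈V X → col′ u ≢ col′ v
        at-ends _ v (inj₁ refl) av v∈X eq = colx≢coly (trans (sym (a-side av v∈X)) (trans (sym eq) col′-a))
        at-ends _ v (inj₂ refl) cv v∈X eq = colx≢coly (trans (sym col′-c) (trans eq (c-side cv v∈X)))
        proper′ : Proper (adj G) X col′
        proper′ u v u∈X v∈X uv with (u ≟ a) ⊎-dec (u ≟ c) | (v ≟ a) ⊎-dec (v ≟ c)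
        ... | yes u-end  | _          = at-ends u v u-end uv v∈X
        ... | no _       | yes v-end  = at-ends v u v-end (adj-flip uv) u∈X ∘ sym
        ... | no u-inner | no v-inner = λ eq →
          proper u v (trans (X′-agrees u≢a u≢c) u∈X) (trans (X′-agrees v≢a v≢c) v∈X) uv
            (trans (sym (col′-inner u≢a u≢c)) (trans eq (col′-inner v≢a v≢c)))
          where
          u≢a = u-inner ∘ inj₁
          u≢c = u-inner ∘ inj₂
          v≢a = v-inner ∘ inj₁
          v≢c = v-inner ∘ inj₂

    shrink : TwoCut G X a b c d → ¬ SeparatingColouring G X a c → adj G a c ≡ true
      → ∃ λ Y → OddSide Y × card Y < card X
    shrink {a = a} {b} {c} {d} cut ¬sep ac with another-neighbour a b c | another-neighbour c d a
    ... | x , ax , x≢b , x≢c | y , cy , y≢d , y≢a =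
      X′ , (x , a , y , c , twoCut′ , ¬sep ∘ separating-extends) , card-X′<card-X
      where open Shrink cut ac ax x≢b x≢c cy y≢d y≢a

    minimal-oddSide⇒goodSide : TwoCut G X a b c d → ¬ SeparatingColouring G X a c
      → (∀ Y → OddSide Y → card X ≤ card Y) → GoodSide G X a c
    minimal-oddSide⇒goodSide {a = a} {c = c} cut ¬sep minimal =
      twoCut-ends-distinct cut , ¬ac , side-twoConnected cut , side-nonbipartite cut ¬sep , side-cubic cut ¬ac
      where
      ¬ac : adj G a c ≡ false
      ¬ac with adj G a c in ac
      ... | false = refl
      ... | true with shrink cut ¬sep ac
      ...   | Y , odd , smaller = contradiction (minimal Y odd) (<⇒≱ smaller)

lemma2p15 : (n : ℕ) (G : SimpleGraph n)
    → TwoConnected (adj G) full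
    → Cubic (adj G) full
    → ¬ Bipartite (adj G) full
    → Σ (VSet n) (λ X → Σ (Fin n) λ a → Σ (Fin n) λ b → Σ (Fin n) λ c → Σ (Fin n) λ d → TwoCut G X a b c d)
    → Σ (VSet n) (λ X → Σ (Fin n) λ a → Σ (Fin n) λ b → Σ (Fin n) λ c → Σ (Fin n) λ d →
        TwoCut G X a b c d × GoodSide G X a c
        × (∀ (Y : VSet n) (a' b' c' d' : Fin n) → TwoCut G Y a' b' c' d' → GoodSide G Y a' c' → card X ≤ card Y))
lemma2p15 n G two-connected cubic ¬bipartite (_ , _ , _ , _ , _ , cut)
  with ∃-minimal card (smaller-oddSide? G) (oddSide-exists G ¬bipartite cut)
... | X , (a , b , c , d , cut , ¬sep) , minimal =
  X , a , b , c , d , cut , minimal-oddSide⇒goodSide G two-connected cubic cut ¬sep minimal ,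
  λ Y a′ b′ c′ d′ cut′ good′ → minimal Y (a′ , b′ , c′ , d′ , cut′ , goodSide⇒¬separating G good′)
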